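{- Let $D$ be a positive integer that is not a perfect square. Suppose that $T_D=2L$ for some positive integer $L$ and that $Q_L=2$. Then $P_L=a_L$ and $a_L\in\{\lfloor\sqrt D\rfloor-1,\lfloor\sqrt D\rfloor\}$.
   Context: For a positive non-square integer $D$, define $\omega_0=\sqrt D$ and recursively $a_k=\lfloor\omega_k\rfloor$, $\omega_{k+1}=1/(\omega_k-a_k)$, so that $\sqrt D=[a_0;a_1,a_2,\ldots]=[a_0;\overline{a_1,\ldots,a_l}]$ with minimal period length $l=T_D$. For each $k\ge0$ one has $\omega_k=\frac{\sqrt D+P_k}{Q_k}$ for uniquely determined integers $P_k,Q_k$ (with $P_0=0$, $Q_0=1$, $P_{k+1}=a_kQ_k-P_k$, $Q_{k+1}=(D-P_{k+1}^2)/Q_k$). -}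

module Defs where

open import Data.Nat as ℕ using (ℕ; zero; suc; _≤?_)
open import Data.Integer as ℤ using (ℤ; +_; -[1+_]; _+_; _-_; _*_; -_; _/ℕ_; _/_)
open import Data.Product using (_×_; _,_; proj₁; proj₂; ∃)
open import Relation.Nullary using (¬_; yes; no)
open import Relation.Binary.PropositionalEquality using (_≡_)

isqrtFrom : ℕ → ℕ → ℕ
isqrtFrom D zero = zero
isqrtFrom D (suc k) with suc k ℕ.* suc k ≤? D
... | yes _ = suc k
... | no  _ = isqrtFrom D k

isqrt : ℕ → ℕ
isqrt D = isqrtFrom D D

IsSquare : ℕ → Set
IsSquare D = ∃ λ n → n ℕ.* n ≡ D

-- ⌊(√D + P)/Q⌋ for non-square D and Q ≠ 0, written out exactly with s = ⌊√D⌋: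
--   Q > 0 :  ⌊(√D+P)/Q⌋ = ⌊(s+P)/Q⌋
--   Q < 0 :  ⌊(√D+P)/Q⌋ = -⌈(√D+P)/|Q|⌉ = -(⌊(s+P)/|Q|⌋ + 1)   (√D irrational)
-- (_/ℕ_ is floor division by a positive natural.)  Q = 0 never occurs; value 0.
floorQ : ℕ → ℤ → ℤ → ℤ
floorQ D P (+ zero)    = + zero
floorQ D P (+ (suc n)) = (+ isqrt D + P) /ℕ suc n
floorQ D P -[1+ n ]    = - (((+ isqrt D + P) /ℕ suc n) + + 1)

-- exact division (Q_k divides D - P_{k+1}^2); divisor 0 never occurs
exdiv : ℤ → ℤ → ℤ
exdiv x (+ zero)    = + zero
exdiv x (+ (suc n)) = x / (+ suc n)
exdiv x -[1+ n ]    = x / -[1+ n ]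

PQ : ℕ → ℕ → ℤ × ℤ
PQ D zero = (+ 0 , + 1)
PQ D (suc k) with PQ D k
... | (P , Q) =
  let a  = floorQ D P Q
      P' = a * Q - P
  in (P' , exdiv (+ D - P' * P') Q)

P : ℕ → ℕ → ℤ
P D k = proj₁ (PQ D k)

Q : ℕ → ℕ → ℤ
Q D k = proj₂ (PQ D k)

a : ℕ → ℕ → ℤ
a D k = floorQ D (P D k) (Q D k)

-- l is a period of the purely periodic part a_1, a_2, ... of √D
IsPeriod : ℕ → ℕ → Set
IsPeriod D l = (1 ℕ.≤ l) × (∀ k → 1 ℕ.≤ k → a D (k ℕ.+ l) ≡ a D k)

IsMinimalPeriod : ℕ → ℕ → Set
IsMinimalPeriod D l = IsPeriod D l × (∀ m → IsPeriod D m → l ℕ.≤ m)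

{-# OPTIONS --safe #-}
-- Let s = ⌊√D⌋. The conditions P ≤ s, 0 < Q ≤ s + P and Q ∣ D - P² (so ω = (√D + P)/Q has
-- ω > 1 and conjugate ω̄ < 0) hold for ω_0 = √D and survive one step of the algorithm, using only
-- s² < D < (s+1)²; the step moreover gives s < P' + Q', i.e. ω̄' > -1, so every ω_k with k ≥ 1
-- is reduced. If Q_L = 2 this leaves P_L ∈ {s - 1, s}, and then a_L = ⌊(s + P_L)/2⌋ = P_L.
module Submission where

open import Defs
open import Data.Nat using (ℕ; _≤_; _*_)
open import Data.Integer using (+_; _-_)
open import Data.Sum using (_⊎_; inj₁; inj₂; map)
open import Data.Product using (_×_; Σ; _,_; proj₁; proj₂)
open import Relation.Nullary using (¬_; yes; no; contradiction)
open import Relation.Binary.PropositionalEquality using (_≡_; refl; sym; trans; cong; subst; module ≡-Reasoning)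

open import Data.Nat as ℕ using (zero; suc; z≤n; s≤s; z<s)
import Data.Nat.Properties as ℕ
open import Data.Integer as ℤ
  using (ℤ; +[1+_]; -[1+_]; 0ℤ; 1ℤ; _+_; _<_; _/ℕ_; _%ℕ_; +≤+; +<+; ∣_∣; NonNegative; nonNegative)
  renaming (_*_ to _·_; _≤_ to _≤ℤ_; suc to sucℤ)
open import Data.Integer.Properties
  using (≤-antisym; ≤-trans; ≤-<-trans; i≤j+i; <⇒≤; i<j⇒suc[i]≤j; i<j⇒i≤pred[j]; pred-suc; suc-*;
         *-cancelʳ-<-nonNeg; *-monoˡ-≤-nonNeg; *-monoʳ-≤-nonNeg; +-monoˡ-<; +-monoʳ-<; +-monoˡ-≤;
         i≤i+j; i-j≤i; i≤j⇒0≤j-i; neg-mono-<; drop‿+<+; 0≤i⇒+∣i∣≡i; +-comm; +-identityʳ; *-distribʳ-+; *-identityˡ; *-comm; pos-*;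
         module ≤-Reasoning)
open import Data.Integer.DivMod using (a≡a%ℕn+[a/ℕn]*n; n%ℕd<d; [n/ℕd]*d≤n; n<s[n/ℕd]*d; div-pos-is-/ℕ)
open import Data.Integer.Tactic.RingSolver using (solve; solve-∀)
open import Data.List using ([]; _∷_)

isqrtFrom-sq≤ : ∀ D k → isqrtFrom D k * isqrtFrom D k ≤ D
isqrtFrom-sq≤ D zero = z≤n
isqrtFrom-sq≤ D (suc k) with suc k * suc k ℕ.≤? D
... | yes [1+k]²≤D = [1+k]²≤D
... | no _ = isqrtFrom-sq≤ D k

<[1+isqrtFrom]² : ∀ D k → D ℕ.< suc k * suc k →
  D ℕ.< suc (isqrtFrom D k) * suc (isqrtFrom D k)
<[1+isqrtFrom]² D zero D<1 = D<1
<[1+isqrtFrom]² D (suc k) D<[2+k]² with suc k * suc k ℕ.≤? D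
... | yes _ = D<[2+k]²
... | no [1+k]²≰D = <[1+isqrtFrom]² D k (ℕ.≰⇒> [1+k]²≰D)

<[1+isqrt]² : ∀ D → D ℕ.< suc (isqrt D) * suc (isqrt D)
<[1+isqrt]² D = <[1+isqrtFrom]² D D (ℕ.<-≤-trans (ℕ.n<1+n D) (ℕ.m≤m*n (suc D) (suc D)))

isqrt-sq< : ∀ D → ¬ IsSquare D → isqrt D * isqrt D ℕ.< D
isqrt-sq< D nonSquare = ℕ.≤∧≢⇒< (isqrtFrom-sq≤ D D) (λ s²≡D → nonSquare (isqrt D , s²≡D))

isqrt-pos : ∀ D → 1 ≤ D → 1 ≤ isqrt D
isqrt-pos D 1≤D with isqrt D | <[1+isqrt]² D
... | zero  | D<1 = contradiction 1≤D (ℕ.<⇒≱ D<1)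
... | suc _ | _   = s≤s z≤n

i<suc[j]⇒i≤j : ∀ {i j} → i < sucℤ j → i ≤ℤ j
i<suc[j]⇒i≤j {i} {j} i<1+j = subst (i ≤ℤ_) (pred-suc j) (i<j⇒i≤pred[j] i<1+j)

/ℕ-unique : ∀ {x q} d .{{_ : ℕ.NonZero d}} → q · + d ≤ℤ x → x < sucℤ q · + d → x /ℕ d ≡ q
/ℕ-unique {x} {q} d qd≤x x<[1+q]d = ≤-antisym
  (i<suc[j]⇒i≤j (*-cancelʳ-<-nonNeg (+ d) (≤-<-trans ([n/ℕd]*d≤n x d) x<[1+q]d)))
  (i<suc[j]⇒i≤j (*-cancelʳ-<-nonNeg (+ d) (≤-<-trans qd≤x (n<s[n/ℕd]*d x d))))

[q*d+r]/ℕd≡q : ∀ q {r} d .{{_ : ℕ.NonZero d}} → r ℕ.< d → (q · + d + + r) /ℕ d ≡ q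
[q*d+r]/ℕd≡q q {r} d r<d = /ℕ-unique d (i≤i+j (q · + d) (+ r)) (begin-strict
  q · + d + + r  <⟨ +-monoʳ-< (q · + d) (+<+ r<d) ⟩
  q · + d + + d  ≡⟨ +-comm (q · + d) (+ d) ⟩
  + d + q · + d  ≡⟨ sym (suc-* q (+ d)) ⟩
  sucℤ q · + d   ∎)
  where open ≤-Reasoning

exdiv-exact : ∀ c n → exdiv (c · + suc n) (+ suc n) ≡ c
exdiv-exact c n = begin
  exdiv (c · + suc n) (+ suc n)  ≡⟨ div-pos-is-/ℕ (c · + suc n) (suc n) ⟩
  (c · + suc n) /ℕ suc n         ≡⟨ cong (_/ℕ suc n) (sym (+-identityʳ (c · + suc n))) ⟩
  (c · + suc n + + 0) /ℕ suc n   ≡⟨ [q*d+r]/ℕd≡q c (suc n) z<s ⟩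
  c                              ∎
  where open ≡-Reasoning

module CompleteQuotients (S D : ℤ) (S²<D : S · S < D) (D<[1+S]² : D < (1ℤ + S) · (1ℤ + S)) where

  record Admissible (P Q : ℤ) : Set where
    field
      0<Q : 0ℤ < Q
      P≤S : P ≤ℤ S
      Q≤S+P : Q ≤ℤ S + P
      cofactor : ℤ
      D-P²≡cofactor*Q : D - P · P ≡ cofactor · Q

  admissible-start : 1ℤ ≤ℤ S → Admissible 0ℤ 1ℤ
  admissible-start 1≤S = record
    { 0<Q = +<+ z<s
    ; P≤S = ≤-trans (+≤+ z≤n) 1≤S
    ; Q≤S+P = subst (1ℤ ≤ℤ_) (sym (+-identityʳ S)) 1≤S
    ; cofactor = D
    ; D-P²≡cofactor*Q = solve (D ∷ [])
    }

  admissible-reduced : ∀ {Q Q' R} → 0ℤ ≤ℤ R → Q ≤ℤ S + (S - R) → R < Q →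
    D - (S - R) · (S - R) ≡ Q' · Q → Admissible (S - R) Q' × S < (S - R) + Q'
  admissible-reduced {Q} {Q'} {R} 0≤R Q≤2S-R R<Q D-[S-R]²≡Q'Q =
    record { 0<Q = ≤-<-trans 0≤R R<Q' ; P≤S = i-j≤i S R ; Q≤S+P = Q'≤2S-R
           ; cofactor = Q ; D-P²≡cofactor*Q = trans D-[S-R]²≡Q'Q (*-comm Q' Q) }
    , S<S-R+Q'
    where
    open ≤-Reasoning
    0<Q : 0ℤ < Q
    0<Q = ≤-<-trans 0≤R R<Q
    instance
      Q≥0 : NonNegative Q
      Q≥0 = nonNegative (<⇒≤ 0<Q)
      R≥0 : NonNegative R
      R≥0 = nonNegative 0≤R
      1+2S-R≥0 : NonNegative (1ℤ + (S + (S - R)))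
      1+2S-R≥0 = nonNegative (≤-trans (<⇒≤ 0<Q) (≤-trans Q≤2S-R (i≤j+i (S + (S - R)) 1ℤ)))
    R<Q' : R < Q'
    R<Q' = *-cancelʳ-<-nonNeg Q (begin-strict
      R · Q                          ≤⟨ *-monoˡ-≤-nonNeg R Q≤2S-R ⟩
      R · (S + (S - R))              ≡⟨ solve (S ∷ R ∷ []) ⟩
      S · S - (S - R) · (S - R)      <⟨ +-monoˡ-< (ℤ.- ((S - R) · (S - R))) S²<D ⟩
      D - (S - R) · (S - R)          ≡⟨ D-[S-R]²≡Q'Q ⟩
      Q' · Q                         ∎)
    Q'≤2S-R : Q' ≤ℤ S + (S - R)
    Q'≤2S-R = i<suc[j]⇒i≤j (*-cancelʳ-<-nonNeg Q (begin-strict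
      Q' · Q                                   ≡⟨ sym D-[S-R]²≡Q'Q ⟩
      D - (S - R) · (S - R)                    <⟨ +-monoˡ-< (ℤ.- ((S - R) · (S - R))) D<[1+S]² ⟩
      (1ℤ + S) · (1ℤ + S) - (S - R) · (S - R)  ≡⟨ solve (S ∷ R ∷ []) ⟩
      (1ℤ + (S + (S - R))) · (1ℤ + R)          ≤⟨ *-monoˡ-≤-nonNeg (1ℤ + (S + (S - R))) (i<j⇒suc[i]≤j R<Q) ⟩
      (1ℤ + (S + (S - R))) · Q                 ∎))
    S<S-R+Q' : S < (S - R) + Q'
    S<S-R+Q' = begin-strict
      S            ≡⟨ solve (S ∷ R ∷ []) ⟩
      (S - R) + R  <⟨ +-monoʳ-< (S - R) R<Q' ⟩
      (S - R) + Q' ∎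

  admissible-step : ∀ {P Q R a} → Admissible P Q → 0ℤ ≤ℤ R → R < Q → S + P ≡ R + a · Q →
    Σ ℤ λ Q' → D - (a · Q - P) · (a · Q - P) ≡ Q' · Q
             × Admissible (a · Q - P) Q' × S < (a · Q - P) + Q'
  admissible-step {P} {Q} {R} {a} adm 0≤R R<Q S+P≡R+aQ =
    Q' , subst Step (sym aQ-P≡S-R) (D-[S-R]²≡Q'Q , admissible-reduced 0≤R Q≤2S-R R<Q D-[S-R]²≡Q'Q)
    where
    open Admissible adm
    Q' : ℤ
    Q' = cofactor + (+ 2 · P · a - a · a · Q)
    Step : ℤ → Set
    Step P' = D - P' · P' ≡ Q' · Q × Admissible P' Q' × S < P' + Q'
    instance
      Q≥0 : NonNegative Q
      Q≥0 = nonNegative (<⇒≤ 0<Q)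
      S-P≥0 : NonNegative (S - P)
      S-P≥0 = nonNegative (i≤j⇒0≤j-i P≤S)
    aQ≡S+P-R : a · Q ≡ (S + P) - R
    aQ≡S+P-R = begin
      a · Q            ≡⟨ solve (R ∷ a ∷ Q ∷ []) ⟩
      (R + a · Q) - R  ≡⟨ cong (_- R) (sym S+P≡R+aQ) ⟩
      (S + P) - R      ∎
      where open ≡-Reasoning
    aQ-P≡S-R : a · Q - P ≡ S - R
    aQ-P≡S-R = begin
      a · Q - P          ≡⟨ cong (_- P) aQ≡S+P-R ⟩
      (S + P) - R - P    ≡⟨ solve (S ∷ P ∷ R ∷ []) ⟩
      S - R              ∎
      where open ≡-Reasoning
    D-[S-R]²≡Q'Q : D - (S - R) · (S - R) ≡ Q' · Q
    D-[S-R]²≡Q'Q = begin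
      D - (S - R) · (S - R)                              ≡⟨ cong (λ p → D - p · p) (sym aQ-P≡S-R) ⟩
      D - (a · Q - P) · (a · Q - P)                      ≡⟨ solve (D ∷ P ∷ a ∷ Q ∷ []) ⟩
      (D - P · P) + (+ 2 · P · a - a · a · Q) · Q        ≡⟨ cong (_+ (+ 2 · P · a - a · a · Q) · Q) D-P²≡cofactor*Q ⟩
      cofactor · Q + (+ 2 · P · a - a · a · Q) · Q       ≡⟨ sym (*-distribʳ-+ Q cofactor (+ 2 · P · a - a · a · Q)) ⟩
      Q' · Q                                             ∎
      where open ≡-Reasoning
    1≤a : 1ℤ ≤ℤ a
    1≤a = i<j⇒suc[i]≤j (*-cancelʳ-<-nonNeg {i = 0ℤ} Q (begin-strict
      0ℤ · Q           ≡⟨ solve (Q ∷ []) ⟩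
      Q - Q            ≤⟨ +-monoˡ-≤ (ℤ.- Q) Q≤S+P ⟩
      (S + P) - Q      <⟨ +-monoʳ-< (S + P) (neg-mono-< R<Q) ⟩
      (S + P) - R      ≡⟨ sym aQ≡S+P-R ⟩
      a · Q            ∎))
      where open ≤-Reasoning
    Q≤2S-R : Q ≤ℤ S + (S - R)
    Q≤2S-R = begin
      Q                       ≡⟨ sym (*-identityˡ Q) ⟩
      1ℤ · Q                  ≤⟨ *-monoʳ-≤-nonNeg Q 1≤a ⟩
      a · Q                   ≤⟨ i≤j+i (a · Q) (S - P) ⟩
      (S - P) + a · Q         ≡⟨ cong (λ x → (S - P) + x) aQ≡S+P-R ⟩
      (S - P) + ((S + P) - R) ≡⟨ solve (S ∷ P ∷ R ∷ []) ⟩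
      S + (S - R)             ∎
      where open ≤-Reasoning

module Expansion (D : ℕ) (1≤D : 1 ≤ D) (nonSquare : ¬ IsSquare D) where

  S : ℤ
  S = + isqrt D

  S²<D : S · S < + D
  S²<D = subst (_< + D) (pos-* (isqrt D) (isqrt D)) (+<+ (isqrt-sq< D nonSquare))

  D<[1+S]² : + D < (1ℤ + S) · (1ℤ + S)
  D<[1+S]² = subst (+ D <_) (pos-* (suc (isqrt D)) (suc (isqrt D))) (+<+ (<[1+isqrt]² D))

  open CompleteQuotients S (+ D) S²<D D<[1+S]² public

  admissible-floor-step : ∀ {P Q} → Admissible P Q →
    let P' = floorQ D P Q · Q - P in
    Admissible P' (exdiv (+ D - P' · P') Q) × S < P' + exdiv (+ D - P' · P') Q
  admissible-floor-step {Q = + zero} record { 0<Q = +<+ () }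
  admissible-floor-step {Q = -[1+ _ ]} record { 0<Q = () }
  admissible-floor-step {P} {Q@(+[1+ n ])} adm =
    exdiv-to-cofactor (admissible-step {a = q} adm (+≤+ z≤n) R<Q S+P≡R+qQ)
    where
    q : ℤ
    q = (S + P) /ℕ suc n
    R<Q : + ((S + P) %ℕ suc n) < Q
    R<Q = +<+ (n%ℕd<d (S + P) (suc n))
    S+P≡R+qQ : S + P ≡ + ((S + P) %ℕ suc n) + q · Q
    S+P≡R+qQ = a≡a%ℕn+[a/ℕn]*n (S + P) (suc n)
    P' : ℤ
    P' = q · Q - P
    exdiv-to-cofactor : Σ ℤ (λ Q' → + D - P' · P' ≡ Q' · Q × Admissible P' Q' × S < P' + Q') →
      Admissible P' (exdiv (+ D - P' · P') Q) × S < P' + exdiv (+ D - P' · P') Q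
    exdiv-to-cofactor (Q' , D-P'²≡Q'Q , adm' , S<P'+Q') =
      subst (λ Q' → Admissible P' Q' × S < P' + Q')
            (sym (trans (cong (λ x → exdiv x Q) D-P'²≡Q'Q) (exdiv-exact Q' n)))
            (adm' , S<P'+Q')

  admissible : ∀ k → Admissible (P D k) (Q D k)
  admissible zero = admissible-start (+≤+ (isqrt-pos D 1≤D))
  admissible (suc k) = proj₁ (admissible-floor-step (admissible k))

  S<P+Q : ∀ k → S < P D (suc k) + Q D (suc k)
  S<P+Q k = proj₂ (admissible-floor-step (admissible k))

i≤j<i+2⇒j≡i⊎j≡i+1 : ∀ {i j} → i ≤ℤ j → j < i + + 2 → j ≡ i ⊎ j ≡ i + 1ℤ
i≤j<i+2⇒j≡i⊎j≡i+1 {i} {j} i≤j j<i+2 = cases ∣ j - i ∣ j≡i+m m<2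
  where
  +m≡j-i : + ∣ j - i ∣ ≡ j - i
  +m≡j-i = 0≤i⇒+∣i∣≡i (i≤j⇒0≤j-i i≤j)
  j≡i+m : j ≡ i + + ∣ j - i ∣
  j≡i+m = begin
    j               ≡⟨ solve (i ∷ j ∷ []) ⟩
    i + (j - i)     ≡⟨ cong (λ x → i + x) (sym +m≡j-i) ⟩
    i + + ∣ j - i ∣ ∎
    where open ≡-Reasoning
  m<2 : ∣ j - i ∣ ℕ.< 2
  m<2 = drop‿+<+ (begin-strict
    + ∣ j - i ∣    ≡⟨ +m≡j-i ⟩
    j - i          <⟨ +-monoˡ-< (ℤ.- i) j<i+2 ⟩
    (i + + 2) - i  ≡⟨ solve (i ∷ []) ⟩
    + 2            ∎)
    where open ≤-Reasoning
  cases : ∀ m → j ≡ i + + m → m ℕ.< 2 → j ≡ i ⊎ j ≡ i + 1ℤ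
  cases zero j≡i+0 _ = inj₁ (trans j≡i+0 (+-identityʳ i))
  cases (suc zero) j≡i+1 _ = inj₂ j≡i+1
  cases (suc (suc _)) _ (s≤s (s≤s ()))

i≤j<i+2⇒[j+i]/ℕ2≡i : ∀ {i j} → i ≤ℤ j → j < i + + 2 → (j + i) /ℕ 2 ≡ i × (i ≡ j - 1ℤ ⊎ i ≡ j)
i≤j<i+2⇒[j+i]/ℕ2≡i {i} i≤j j<i+2 with i≤j<i+2⇒j≡i⊎j≡i+1 i≤j j<i+2
... | inj₁ refl = trans (cong (_/ℕ 2) (i+i≡i*2+0 i)) ([q*d+r]/ℕd≡q i 2 z<s) , inj₂ refl
  where
  i+i≡i*2+0 : ∀ i → i + i ≡ i · + 2 + + 0
  i+i≡i*2+0 = solve-∀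
... | inj₂ refl = trans (cong (_/ℕ 2) (i+1+i≡i*2+1 i)) ([q*d+r]/ℕd≡q i 2 (s≤s z<s)) , inj₁ (i≡i+1-1 i)
  where
  i+1+i≡i*2+1 : ∀ i → i + 1ℤ + i ≡ i · + 2 + + 1
  i+1+i≡i*2+1 = solve-∀
  i≡i+1-1 : ∀ i → i ≡ i + 1ℤ - 1ℤ
  i≡i+1-1 = solve-∀

proposition2p5 : (D L : ℕ) → 1 ≤ D → ¬ IsSquare D → 1 ≤ L →
    IsMinimalPeriod D (2 * L) → Q D L ≡ + 2 →
    (P D L ≡ a D L) × ((a D L ≡ + isqrt D - + 1) ⊎ (a D L ≡ + isqrt D))
proposition2p5 D zero _ _ () _ _
proposition2p5 D L@(suc k) 1≤D nonSquare _ _ Q≡2 =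
  sym a≡P , map (trans a≡P) (trans a≡P) (proj₂ [S+P]/2≡P∈[S-1,S])
  where
  open Expansion D 1≤D nonSquare
  S<P+2 : S < P D L + + 2
  S<P+2 = subst (λ q → S < P D L + q) Q≡2 (S<P+Q k)
  [S+P]/2≡P∈[S-1,S] : (S + P D L) /ℕ 2 ≡ P D L × (P D L ≡ S - 1ℤ ⊎ P D L ≡ S)
  [S+P]/2≡P∈[S-1,S] = i≤j<i+2⇒[j+i]/ℕ2≡i (Admissible.P≤S (admissible L)) S<P+2
  a≡P : a D L ≡ P D L
  a≡P = trans (cong (floorQ D (P D L)) Q≡2) (proj₁ [S+P]/2≡P∈[S-1,S])
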